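{- Let $\mathcal V=\langle A,a_z,\delta,\vec x_{in},Q,T,q_{in}\rangle$ be a VASSZ of dimension $d$. A control state $q_f$ is visited infinitely often if and only if there exist $\vec x,\vec y\in\mathbb N^d$ and a word $w$ such that $(q_{in},\vec x_{in})\xrightarrow{*}(q_f,\vec x)\xrightarrow{w}(q_f,\vec y)$ and one of the following holds: (i) $\vec x\le\vec y$ and $w\in A^+$; or (ii) $\vec x\le_{\{1\}}\vec y$ and $w\in(A\cup\{a_z\})^+$.
   Context: A VASSZ of dimension $d$ is $\langle A,a_z,\delta,\vec x_{in},Q,T,q_{in}\rangle$ with $A$ finite, $a_z\notin A$, $\delta:A\cup\{a_z\}\to\mathbb Z^d$, $\vec x_{in}\in\mathbb N^d$, $Q$ nonempty finite, $T\subseteq Q\times(A\cup\{a_z\})\times Q$ finite, $q_{in}\in Q$. For states $(p,\vec x),(q,\vec y)\in Q\times\mathbb N^d$: $(p,\vec x)\xrightarrow{a}(q,\vec y)$ iff $(p,a,q)\in T$, $\vec y-\vec x=\delta(a)$, and, if $a=a_z$, $\vec x(1)=0$. Extend to words by composition; $\xrightarrow{*}$ (resp. $\xrightarrow{+}$) is the union over all words (resp. nonempty words). $q_f$ is visited infinitely often if there is an infinite sequence $(\vec x_j)_{j>0}$ in $\mathbb N^d$ with $(q_{in},\vec x_{in})\xrightarrow{*}(q_f,\vec x_1)$ and $(q_f,\vec x_j)\xrightarrow{+}(q_f,\vec x_{j+1})$ for all $j>0$. $\le$ is the componentwise order; $\vec x\le_{\{1\}}\vec y$ means $\vec x(1)=\vec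 y(1)$ and $\vec x(i)\le\vec y(i)$ for all $i$. -}

module Defs where

open import Data.Nat using (ℕ; suc; _≤_)
open import Data.Integer using (ℤ; +_; _-_)
open import Data.Fin using (Fin; zero)
open import Data.List using (List; []; _∷_; length)
open import Data.List.Membership.Propositional using (_∈_)
open import Data.List.Relation.Unary.All using (All)
open import Data.Product using (_×_; _,_; ∃; Σ-syntax)
open import Relation.Binary.PropositionalEquality using (_≡_)

-- Vectors of ℕ^d / ℤ^d as functions on coordinates (coordinate 1 = Fin.zero).
ℕ^ : ℕ → Set
ℕ^ d = Fin d → ℕ

ℤ^ : ℕ → Set
ℤ^ d = Fin d → ℤ

-- Letters: the finite alphabet A is Fin nA (as `act a`), plus the distinct
-- zero-test letter a_z (`az`), which is therefore not in A.
data Letter (nA : ℕ) : Set where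
  act : Fin nA → Letter nA
  az  : Letter nA

record VASSZ (d : ℕ) : Set where
  field
    nA   : ℕ
    δ    : Letter nA → ℤ^ d
    xin  : ℕ^ d
    nQ   : ℕ
    T    : List (Fin (suc nQ) × Letter nA × Fin (suc nQ))
    qin  : Fin (suc nQ)

  Q : Set
  Q = Fin (suc nQ)

  Word : Set
  Word = List (Letter nA)

module Semantics {d : ℕ} (V : VASSZ (suc d)) where
  open VASSZ V

  ZeroOK : Letter nA → ℕ^ (suc d) → Set
  ZeroOK (act _) x = Data.Unit.⊤ where import Data.Unit
  ZeroOK az x = x zero ≡ 0

  record Step (p : Q) (x : ℕ^ (suc d)) (a : Letter nA) (q : Q) (y : ℕ^ (suc d)) : Set where
    field
      inT   : (p , a , q) ∈ T
      delta : ∀ i → (+ y i) - (+ x i) ≡ δ a i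
      ztest : ZeroOK a x

  data Steps : Q → ℕ^ (suc d) → Word → Q → ℕ^ (suc d) → Set where
    done : ∀ {p x} → Steps p x [] p x
    step : ∀ {p x a q y w r z} → Step p x a q y → Steps q y w r z → Steps p x (a ∷ w) r z

  Reach : Q → ℕ^ (suc d) → Q → ℕ^ (suc d) → Set
  Reach p x q y = ∃ λ w → Steps p x w q y

  Reach⁺ : Q → ℕ^ (suc d) → Q → ℕ^ (suc d) → Set
  Reach⁺ p x q y = Σ[ w ∈ Word ] (1 ≤ length w × Steps p x w q y)

  VisitedInfinitelyOften : Q → Set
  VisitedInfinitelyOften qf =
    Σ[ xs ∈ (ℕ → ℕ^ (suc d)) ]
      (Reach qin xin qf (xs 0) × (∀ j → Reach⁺ qf (xs j) qf (xs (suc j))))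

  _≤ᵥ_ : ℕ^ (suc d) → ℕ^ (suc d) → Set
  x ≤ᵥ y = ∀ i → x i ≤ y i

  _≤₁_ : ℕ^ (suc d) → ℕ^ (suc d) → Set
  x ≤₁ y = x zero ≡ y zero × x ≤ᵥ y

  IsAct : Letter nA → Set
  IsAct (act _) = Data.Unit.⊤ where import Data.Unit
  IsAct az = Data.Empty.⊥ where import Data.Empty

module Submission where

-- Backward (pump): such a loop can be repeated forever, since adding
-- y - x to every configuration of a run keeps it a run as long as the run
-- has no zero tests or y - x leaves counter 1 unchanged.
--
-- Forward: along an infinite run through q, record for every visit its
-- configuration and its latest anchor, i.e. the configuration just before
-- the latest zero test.  Since these keys live in a well-quasi-order,
-- two of them are comparable.  If no zero test happened in between, this
-- is a loop of the first kind; otherwise both visits have anchors at the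
-- same state, and replaying the later part from the larger anchor gives a
-- loop of the second kind.  Well-quasi-orders are treated constructively
-- as almost-full relations (module AlmostFull), for which Dickson's lemma
-- follows from the intersection theorem.

open import Defs
open import Data.Nat using (ℕ; suc; _≤_)
open import Data.List using (length)
open import Data.List.Relation.Unary.All using (All)
open import Data.Product using (_×_; Σ-syntax)
open import Data.Sum using (_⊎_)
open import Function.Bundles using (_⇔_)

open import Data.Nat using (zero; _<_; _+_; _*_; _∸_; z≤n; s≤s; _≤?_; _<?_; _≤′_; ≤′-refl; ≤′-step)
open import Data.Nat.Properties
  using (≤-trans; ≤-pred; ≰⇒>; ≮⇒≥; <⇒≱; ∸-monoʳ-<; +-comm; +-assoc; *-zeroʳ; m∸n+n≡m; n∸n≡0; m≤n+m; ≤⇒≤′)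
open import Data.Integer using (+_; _-_; _⊖_)
import Data.Integer.Properties as ℤP
open import Data.Fin using (Fin; toℕ) renaming (zero to fz; suc to fs)
open import Data.Fin.Properties using (toℕ≤n; suc-injective)
import Data.Fin.Properties as FinP
open import Data.List using ([]; _∷_; _++_)
open import Data.List.Relation.Unary.All using ([]; _∷_)
import Data.List.Relation.Unary.All as All
open import Data.List.Relation.Unary.All.Properties using (++⁺)
open import Data.Maybe using (Maybe; just; nothing)
import Data.Maybe as Maybe
open import Data.Product using (_,_; proj₁; proj₂)
open import Data.Sum using (inj₁; inj₂)
import Data.Sum as Sum
open import Data.Unit using (tt)
open import Data.Empty using (⊥)
open import Function using (_∘_; _on_)
open import Function.Bundles using (mk⇔)
open import Level using (0ℓ)
open import Relation.Binary.Core using (Rel; _⇒_)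
open import Relation.Binary.Construct.Union using (_∪_)
open import Relation.Binary.Construct.Intersection using (_∩_)
open import Relation.Binary.Construct.Constant.Core using (Const)
open import Relation.Binary.PropositionalEquality
open import Relation.Nullary using (Dec; yes; no; contradiction)

module AlmostFull where

  -- After an element x has been seen, a pair (y, z) is good for R if
  -- R y z holds, or if y already forms a good pair with x.
  _↑_ : {X : Set} → Rel X 0ℓ → X → Rel X 0ℓ
  (R ↑ x) y z = R y z ⊎ R x y

  data AF {X : Set} (R : Rel X 0ℓ) : Set₁ where
    now   : (∀ x y → R x y) → AF R
    later : (∀ x → AF (R ↑ x)) → AF R

  onLeft : {X : Set} → (X → Set) → Rel X 0ℓ
  onLeft A y _ = A y

  private variable
    X Y : Set
    R S S′ T : Rel X 0ℓ
    A B : X → Set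
    P Q : Set

  af-mono : R ⇒ S → AF R → AF S
  af-mono R⇒S (now total) = now λ x y → R⇒S (total x y)
  af-mono R⇒S (later k)   = later λ x → af-mono (Sum.map R⇒S R⇒S) (k x)

  af-good : AF R → (f : ℕ → X) → Σ[ i ∈ ℕ ] Σ[ j ∈ ℕ ] (i < j × R (f i) (f j))
  af-good (now total) f = 0 , 1 , s≤s z≤n , total (f 0) (f 1)
  af-good (later k) f with af-good (k (f 0)) (f ∘ suc)
  ... | i , j , i<j , inj₁ r = suc i , suc j , s≤s i<j , r
  ... | i , j , i<j , inj₂ r = 0 , suc i , s≤s z≤n , r

  af-comap : (g : X → Y) → AF R → AF (R on g)
  af-comap g (now total) = now λ x y → total (g x) (g y)
  af-comap g (later k)   = later λ x → af-comap g (k (g x))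

  -- The intersection theorem (Coquand; Vytiniotis, Coquand and Wahlstedt,
  -- "Stop when you are almost-full").  It is proved through two
  -- generalisations in which R is united with a constant proposition or
  -- with a predicate on the left element; the relations S and S′ on which
  -- the induction runs are only required to be contained in these unions.

  ∪-× : {C : Set} → C ⊎ P → C ⊎ Q → C ⊎ (P × Q)
  ∪-× (inj₁ c) _        = inj₁ c
  ∪-× (inj₂ p) (inj₁ c) = inj₁ c
  ∪-× (inj₂ p) (inj₂ q) = inj₂ (p , q)

  ⇒-∪-↑ : {E : Rel X 0ℓ} → S ⇒ R ∪ E → ∀ x → S ⇒ (R ↑ x) ∪ E
  ⇒-∪-↑ S⇒ x {y} {z} s = Sum.map₁ inj₁ (S⇒ {y} {z} s)

  ↑-∪-const : S ⇒ R ∪ Const P → ∀ x → S ↑ x ⇒ (R ↑ x) ∪ Const P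
  ↑-∪-const S⇒ _ (inj₁ s) = Sum.map₁ inj₁ (S⇒ s)
  ↑-∪-const S⇒ _ (inj₂ s) = Sum.map₁ inj₂ (S⇒ s)

  ↑-∪-onLeft : S ⇒ R ∪ onLeft A → ∀ x → S ↑ x ⇒ (R ↑ x) ∪ onLeft (λ y → A y ⊎ A x)
  ↑-∪-onLeft S⇒ _ (inj₁ s) = Sum.map inj₁ inj₁ (S⇒ s)
  ↑-∪-onLeft S⇒ _ (inj₂ s) = Sum.map inj₂ inj₂ (S⇒ s)

  af-∪-const : AF S → AF S′ → S ⇒ R ∪ Const P → S′ ⇒ R ∪ Const Q →
               AF (R ∪ Const (P × Q))
  af-∪-const aS (now total) S⇒ S′⇒ = af-mono (λ s → ∪-× (S⇒ s) (S′⇒ (total _ _))) aS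
  af-∪-const {S = S} {S′ = S′} {R = R} aS (later k) S⇒ S′⇒ = later λ x →
    af-mono regroup (af-∪-const {R = R ↑ x} aS (k x) (⇒-∪-↑ {S = S} S⇒ x) (↑-∪-const {S = S′} S′⇒ x))
    where
    regroup : ∀ {x C} → (R ↑ x) ∪ Const C ⇒ (R ∪ Const C) ↑ x
    regroup (inj₁ (inj₁ r)) = inj₁ (inj₁ r)
    regroup (inj₁ (inj₂ r)) = inj₂ (inj₁ r)
    regroup (inj₂ c)        = inj₁ (inj₂ c)

  -- Unary intersection theorem, by induction on both relations; the
  -- lifted case is reduced to the nullary one.
  af-∪-onLeft : AF S → AF S′ → S ⇒ R ∪ onLeft A → S′ ⇒ R ∪ onLeft B →
                AF (R ∪ onLeft (λ y → A y × B y))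
  af-∪-onLeft (now total) aS′ S⇒ S′⇒ = af-mono (λ s′ → ∪-× (S⇒ (total _ _)) (S′⇒ s′)) aS′
  af-∪-onLeft aS (now total) S⇒ S′⇒ = af-mono (λ s → ∪-× (S⇒ s) (S′⇒ (total _ _))) aS
  af-∪-onLeft {S = S} {S′ = S′} {R = R} {A = A} {B = B} (later k) (later k′) S⇒ S′⇒ = later λ x →
    af-mono regroup
      (af-∪-const {R = (R ↑ x) ∪ onLeft (λ y → A y × B y)}
        (af-∪-onLeft {R = R ↑ x} (k x) (later k′) (↑-∪-onLeft {S = S} S⇒ x) (⇒-∪-↑ {S = S′} S′⇒ x))
        (af-∪-onLeft {R = R ↑ x} (later k) (k′ x) (⇒-∪-↑ {S = S} S⇒ x) (↑-∪-onLeft {S = S′} S′⇒ x))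
        splitA splitB)
    where
    splitA : ∀ {x} → (R ↑ x) ∪ onLeft (λ y → (A y ⊎ A x) × B y) ⇒
                     ((R ↑ x) ∪ onLeft (λ y → A y × B y)) ∪ Const (A x)
    splitA (inj₁ r)              = inj₁ (inj₁ r)
    splitA (inj₂ (inj₁ a , b))   = inj₁ (inj₂ (a , b))
    splitA (inj₂ (inj₂ a , _))   = inj₂ a
    splitB : ∀ {x} → (R ↑ x) ∪ onLeft (λ y → A y × (B y ⊎ B x)) ⇒
                     ((R ↑ x) ∪ onLeft (λ y → A y × B y)) ∪ Const (B x)
    splitB (inj₁ r)              = inj₁ (inj₁ r)
    splitB (inj₂ (a , inj₁ b))   = inj₁ (inj₂ (a , b))
    splitB (inj₂ (_ , inj₂ b))   = inj₂ b
    regroup : ∀ {x} → ((R ↑ x) ∪ onLeft (λ y → A y × B y)) ∪ Const (A x × B x) ⇒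
                      (R ∪ onLeft (λ y → A y × B y)) ↑ x
    regroup (inj₁ (inj₁ (inj₁ r))) = inj₁ (inj₁ r)
    regroup (inj₁ (inj₁ (inj₂ r))) = inj₂ (inj₁ r)
    regroup (inj₁ (inj₂ ab))       = inj₁ (inj₂ ab)
    regroup (inj₂ ab)              = inj₂ (inj₂ ab)

  af-∩ : AF R → AF T → AF (R ∩ T)
  af-∩ (now total) aT = af-mono (λ t → total _ _ , t) aT
  af-∩ aR (now total) = af-mono (λ r → r , total _ _) aR
  af-∩ {R = R} {T = T} (later k) (later k′) = later λ x →
    af-∪-onLeft (af-∩ (k x) (later k′)) (af-∩ (later k) (k′ x)) splitR splitT
    where
    splitR : ∀ {x} → (R ↑ x) ∩ T ⇒ (R ∩ T) ∪ onLeft (R x)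
    splitR (inj₁ r , t) = inj₁ (r , t)
    splitR (inj₂ r , _) = inj₂ r
    splitT : ∀ {x} → R ∩ (T ↑ x) ⇒ (R ∩ T) ∪ onLeft (T x)
    splitT (r , inj₁ t) = inj₁ (r , t)
    splitT (_ , inj₂ t) = inj₂ t

  af-≤-above : ∀ n → AF (λ y z → y ≤ z ⊎ n ≤ y)
  af-≤-above zero    = now λ _ _ → inj₂ z≤n
  af-≤-above (suc n) = later λ x → after x (suc n ≤? x)
    where
    after : ∀ x → Dec (suc n ≤ x) → AF ((λ y z → y ≤ z ⊎ suc n ≤ y) ↑ x)
    after x (yes n<x) = now λ _ _ → inj₂ (inj₂ n<x)
    after x (no n≮x)  = af-mono reach (af-≤-above n)
      where
      reach : (λ y z → y ≤ z ⊎ n ≤ y) ⇒ (λ y z → y ≤ z ⊎ suc n ≤ y) ↑ x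
      reach (inj₁ y≤z) = inj₁ (inj₁ y≤z)
      reach (inj₂ n≤y) = inj₂ (inj₁ (≤-trans (≤-pred (≰⇒> n≮x)) n≤y))

  -- ≤ on ℕ is almost full: after the first element x, use the bound x.
  af-≤ : AF _≤_
  af-≤ = later af-≤-above

  af-pointwise : AF R → ∀ n → AF (λ (u v : Fin n → X) → ∀ i → R (u i) (v i))
  af-pointwise aR zero    = now λ _ _ ()
  af-pointwise {X = X} {R = R} aR (suc n) =
    af-mono cons (af-∩ (af-comap (λ u → u fz) aR) (af-comap (λ u → u ∘ fs) (af-pointwise aR n)))
    where
    cons : ∀ {u v : Fin (suc n) → X} → R (u fz) (v fz) × (∀ i → R (u (fs i)) (v (fs i))) →
           ∀ i → R (u i) (v i)
    cons (r , _)  fz     = r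
    cons (_ , rs) (fs i) = rs i

  -- Equality on Fin n is almost full: it is the intersection of
  -- ≤ and of ≤ read through the order-reversing map i ↦ n ∸ i.
  af-≡-Fin : ∀ n → AF (_≡_ {A = Fin n})
  af-≡-Fin n = af-mono antisym (af-∩ (af-comap toℕ af-≤) (af-comap (λ i → n ∸ toℕ i) af-≤))
    where
    reflect : ∀ (i j : Fin n) → n ∸ toℕ i ≤ n ∸ toℕ j → toℕ j ≤ toℕ i
    reflect i j n∸i≤n∸j with toℕ i <? toℕ j
    ... | yes i<j = contradiction n∸i≤n∸j (<⇒≱ (∸-monoʳ-< i<j (toℕ≤n j)))
    ... | no  i≮j = ≮⇒≥ i≮j
    antisym : ∀ {i j : Fin n} → toℕ i ≤ toℕ j × n ∸ toℕ i ≤ n ∸ toℕ j → i ≡ j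
    antisym {i} {j} (i≤j , n∸i≤n∸j) = FinP.≤-antisym i≤j (reflect i j n∸i≤n∸j)

open AlmostFull

module Loops {d : ℕ} (V : VASSZ (suc d)) where
  open VASSZ V
  open Semantics V

  Conf : Set
  Conf = ℕ^ (suc d)

  private variable
    p q r : Q
    x y z x′ y′ : Conf
    u w : Word
    a : Letter nA

  _++ᴿ_ : Steps p x u q y → Steps q y w r z → Steps p x (u ++ w) r z
  done     ++ᴿ t = t
  step s ρ ++ᴿ t = step s (ρ ++ᴿ t)

  reach-trans : Reach p x q y → Reach q y r z → Reach p x r z
  reach-trans (u , ρ) (w , σ) = u ++ w , ρ ++ᴿ σ

  forget-nonempty : Reach⁺ p x q y → Reach p x q y
  forget-nonempty (w , _ , σ) = w , σ

  nonempty-++ˡ : (u w : Word) → 1 ≤ length u → 1 ≤ length (u ++ w)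
  nonempty-++ˡ (_ ∷ _) _ _ = s≤s z≤n

  nonempty-++ʳ : (u w : Word) → 1 ≤ length w → 1 ≤ length (u ++ w)
  nonempty-++ʳ []      _ ne = ne
  nonempty-++ʳ (_ ∷ _) _ _  = s≤s z≤n

  _+ᶜ_ : Conf → Conf → Conf
  (v +ᶜ x) i = v i + x i

  -- v may be added along the run of w when v does not change the tested
  -- counter, or when w performs no zero test.
  Translatable : Conf → Word → Set
  Translatable v w = v fz ≡ 0 ⊎ All IsAct w

  zero-test-translate : (v : Conf) → v fz ≡ 0 ⊎ IsAct a → ZeroOK a x → x′ fz ≡ v fz + x fz → ZeroOK a x′
  zero-test-translate {a = act _} v _          _     _  = tt
  zero-test-translate {a = az}    v (inj₁ v≡0) x≡0 x′≡ = trans x′≡ (cong₂ _+_ v≡0 x≡0)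

  -- The displacement of a step is invariant under translation.
  translate-step : (v : Conf) → v fz ≡ 0 ⊎ IsAct a → x′ ≗ v +ᶜ x → y′ ≗ v +ᶜ y →
                   Step p x a q y → Step p x′ a q y′
  translate-step {a = a} {x′ = x′} {x = x} {y′ = y′} {y = y} v ok x′≗ y′≗ s = record
    { inT   = Step.inT s
    ; delta = displacement
    ; ztest = zero-test-translate v ok (Step.ztest s) (x′≗ fz) }
    where
    open ≡-Reasoning
    displacement : ∀ i → + y′ i - + x′ i ≡ δ a i
    displacement i = begin
      + y′ i - + x′ i                ≡⟨ cong₂ (λ m n → + m - + n) (y′≗ i) (x′≗ i) ⟩
      + (v i + y i) - + (v i + x i)  ≡⟨ ℤP.m-n≡m⊖n (v i + y i) (v i + x i) ⟩
      (v i + y i) ⊖ (v i + x i)      ≡⟨ ℤP.+-cancelˡ-⊖ (v i) (y i) (x i) ⟩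
      y i ⊖ x i                      ≡⟨ ℤP.m-n≡m⊖n (y i) (x i) ⟨
      + y i - + x i                  ≡⟨ Step.delta s i ⟩
      δ a i                          ∎

  -- Translation lemma for nonempty runs (the endpoints are only given
  -- pointwise, hence nonemptiness).
  translate : (v : Conf) → Translatable v w → 1 ≤ length w → x′ ≗ v +ᶜ x → y′ ≗ v +ᶜ y →
              Steps p x w q y → Steps p x′ w q y′
  translate v ok _ x′≗ y′≗ (step s done) =
    step (translate-step v (Sum.map₂ All.head ok) x′≗ y′≗ s) done
  translate v ok _ x′≗ y′≗ (step s ρ@(step _ _)) =
    step (translate-step v (Sum.map₂ All.head ok) x′≗ (λ _ → refl) s)
         (translate v (Sum.map₂ All.tail ok) (s≤s z≤n) (λ _ → refl) y′≗ ρ)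

  GoodLoop : Q → Set
  GoodLoop q = Σ[ x ∈ Conf ] Σ[ y ∈ Conf ] Σ[ w ∈ Word ]
    (Reach qin xin q x × Steps q x w q y ×
      ((x ≤ᵥ y × 1 ≤ length w × All IsAct w) ⊎ (x ≤₁ y × 1 ≤ length w)))

  -- Pumping: a reachable loop (q, x) -w-> (q, y) with x ≤ y, along which
  -- v = y - x is translatable, can be iterated forever, the j-th
  -- iteration running from j·v + x to (j+1)·v + x.
  pump : Reach qin xin q x → Steps q x w q y → x ≤ᵥ y → 1 ≤ length w →
         Translatable (λ i → y i ∸ x i) w → VisitedInfinitelyOften q
  pump {q = q} {x = x} {w = w} {y = y} ρ σ x≤y ne ok = iterate , ρ , loop
    where
    v : Conf
    v i = y i ∸ x i
    iterate : ℕ → Conf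
    iterate j = (λ i → j * v i) +ᶜ x
    after : ∀ j → iterate (suc j) ≗ (λ i → j * v i) +ᶜ y
    after j i = begin
      (v i + j * v i) + x i  ≡⟨ cong (_+ x i) (+-comm (v i) (j * v i)) ⟩
      (j * v i + v i) + x i  ≡⟨ +-assoc (j * v i) (v i) (x i) ⟩
      j * v i + (v i + x i)  ≡⟨ cong (λ n → j * v i + n) (m∸n+n≡m (x≤y i)) ⟩
      j * v i + y i          ∎
      where open ≡-Reasoning
    scaled : ∀ j → Translatable (λ i → j * v i) w
    scaled j = Sum.map₁ (λ v≡0 → trans (cong (j *_) v≡0) (*-zeroʳ j)) ok
    loop : ∀ j → Reach⁺ q (iterate j) q (iterate (suc j))
    loop j = w , ne , translate (λ i → j * v i) (scaled j) ne (λ _ → refl) (after j) σ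

  -- Backward direction: both kinds of loops are translatable by y - x.
  loop⇒visited : ∀ q → GoodLoop q → VisitedInfinitelyOften q
  loop⇒visited q (x , y , w , ρ , σ , inj₁ (x≤y , ne , acts)) = pump ρ σ x≤y ne (inj₂ acts)
  loop⇒visited q (x , y , w , ρ , σ , inj₂ ((x₁≡y₁ , x≤y) , ne)) =
    pump ρ σ x≤y ne (inj₁ (trans (cong (_∸ x fz) (sym x₁≡y₁)) (n∸n≡0 (x fz))))

  -- An anchor of (q, y): a configuration whose first counter is zero,
  -- from which (q, y) is reached by a nonempty run.  Zero tests only
  -- happen at such configurations.
  record Anchor (q : Q) (y : Conf) : Set where
    constructor anchor
    field
      state  : Q
      conf   : Conf
      tested : conf fz ≡ 0
      run    : Reach⁺ state conf q y
  open Anchor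

  split : Steps p x w q y → All IsAct w ⊎ Σ[ α ∈ Anchor q y ] Reach p x (state α) (conf α)
  split done = inj₁ []
  split (step {a = act _} s σ) with split σ
  ... | inj₁ acts        = inj₁ (tt ∷ acts)
  ... | inj₂ (α , u , τ) = inj₂ (α , _ ∷ u , step s τ)
  split (step {a = az} s σ) = inj₂ (anchor _ _ (Step.ztest s) (_ , s≤s z≤n , step s σ) , [] , done)

  extend : Anchor q y → Steps q y w r z → Anchor r z
  extend {w = w} (anchor p c c≡0 (u , ne , ρ)) σ = anchor p c c≡0 (u ++ w , nonempty-++ˡ u w ne , ρ ++ᴿ σ)

  -- The latest anchor of a configuration on q, updated along a loop on q
  -- (there is none before the first zero test).
  next : Steps q y w q y′ → Maybe (Anchor q y) → Maybe (Anchor q y′)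
  next σ m with split σ
  ... | inj₁ _       = Maybe.map (λ α → extend α σ) m
  ... | inj₂ (α , _) = just α

  ActRun : Q → Conf → Conf → Set
  ActRun q x y = Σ[ w ∈ Word ] (All IsAct w × 1 ≤ length w × Steps q x w q y)

  ReachesAnchor : Conf → Maybe (Anchor q y) → Set
  ReachesAnchor {q = q} x (just α) = Reach q x (state α) (conf α)
  ReachesAnchor         x nothing  = ⊥

  -- The invariant maintained along an infinite run: an earlier
  -- configuration x on q reaches the later configuration y either
  -- without zero tests, or through the latest anchor of y.
  Linked : Q → Conf → (y : Conf) → Maybe (Anchor q y) → Set
  Linked q x y m = ActRun q x y ⊎ ReachesAnchor x m

  linked-reach : (m : Maybe (Anchor q y)) → Linked q x y m → Reach q x q y
  linked-reach m        (inj₁ (w , _ , _ , σ)) = w , σ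
  linked-reach (just α) (inj₂ ρ)               = reach-trans ρ (forget-nonempty (run α))

  linked-start : (σ : Steps q y w q y′) → 1 ≤ length w → (m : Maybe (Anchor q y)) →
                 Linked q y y′ (next σ m)
  linked-start σ ne m with split σ
  ... | inj₁ acts    = inj₁ (_ , acts , ne , σ)
  ... | inj₂ (α , ρ) = inj₂ ρ

  linked-extend : All IsAct w → (σ : Steps q y w q y′) → (m : Maybe (Anchor q y)) →
                  Linked q x y m → Linked q x y′ (Maybe.map (λ α → extend α σ) m)
  linked-extend {w = w} acts σ m (inj₁ (u , acts′ , ne , ρ)) =
    inj₁ (u ++ w , ++⁺ acts′ acts , nonempty-++ˡ u w ne , ρ ++ᴿ σ)
  linked-extend acts σ (just α) (inj₂ ρ) = inj₂ ρ

  -- Any loop preserves a link: a loop with a zero test provides a new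
  -- anchor, reached from x through the old link.
  linked-step : (σ : Steps q y w q y′) → (m : Maybe (Anchor q y)) →
                Linked q x y m → Linked q x y′ (next σ m)
  linked-step σ m l with split σ
  ... | inj₁ acts    = linked-extend acts σ m l
  ... | inj₂ (α , ρ) = inj₂ (reach-trans (linked-reach m l) ρ)

  -- Two anchors at the same state with ordered configurations c ≤ c′,
  -- where x reaches the second one, give a loop on x preserving
  -- counter 1: go to c′ and replay the run from c, translated by c′ - c
  -- (whose first coordinate is 0 since both anchors have it 0).
  anchor-loop : (α : Anchor q x) (β : Anchor q x′) → state α ≡ state β → conf α ≤ᵥ conf β →
                Reach q x (state β) (conf β) →
                Σ[ y ∈ Conf ] Σ[ w ∈ Word ] (Steps q x w q y × x ≤₁ y × 1 ≤ length w)
  anchor-loop {x = x} (anchor p c c≡0 (w , ne , σ)) (anchor .p c′ c′≡0 _) refl c≤c′ (u , ρ) =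
    v +ᶜ x , u ++ w , ρ ++ᴿ translate v (inj₁ v≡0) ne (λ i → sym (m∸n+n≡m (c≤c′ i))) (λ _ → refl) σ ,
    (cong (_+ x fz) (sym v≡0) , λ i → m≤n+m (x i) (v i)) , nonempty-++ʳ u w ne
    where
    v : Conf
    v i = c′ i ∸ c i
    v≡0 : v fz ≡ 0
    v≡0 = cong₂ _∸_ c′≡0 c≡0

  -- The data compared along the infinite run: the configuration, the
  -- state of its latest anchor (if any) and that anchor's configuration.
  Key : Set
  Key = Conf × Fin (suc (suc nQ)) × Conf

  _≼_ : Key → Key → Set
  _≼_ = (_≤ᵥ_ on proj₁) ∩ ((_≡_ on (proj₁ ∘ proj₂)) ∩ (_≤ᵥ_ on (proj₂ ∘ proj₂)))

  -- ≼ is almost full (Dickson's lemma and finiteness of the states).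
  af-≼ : AF _≼_
  af-≼ = af-∩ (af-comap proj₁ af-≤ᵥ)
               (af-∩ (af-comap (proj₁ ∘ proj₂) (af-≡-Fin (suc (suc nQ))))
                     (af-comap (proj₂ ∘ proj₂) af-≤ᵥ))
    where
    af-≤ᵥ : AF _≤ᵥ_
    af-≤ᵥ = af-pointwise af-≤ (suc d)

  anchorState : Maybe (Anchor q y) → Fin (suc (suc nQ))
  anchorState nothing  = fz
  anchorState (just α) = fs (state α)

  anchorConf : Maybe (Anchor q y) → Conf
  anchorConf nothing  = λ _ → 0
  anchorConf (just α) = conf α

  -- Nonexistence of an anchor is coded by state fz.
  key : (y : Conf) → Maybe (Anchor q y) → Key
  key y m = y , anchorState m , anchorConf m

  -- A ≼-good pair of linked configurations yields a good loop: a
  -- zero-test-free link gives the first kind, a link through the latest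
  -- anchor gives the second kind by anchor-loop (equal keys exclude the
  -- case where the earlier configuration has no anchor).
  good-pair⇒loop : Reach qin xin q x → (m : Maybe (Anchor q x)) (m′ : Maybe (Anchor q x′)) →
                   key x m ≼ key x′ m′ → Linked q x x′ m′ → GoodLoop q
  good-pair⇒loop ρ m m′ (x≤x′ , _) (inj₁ (w , acts , ne , σ)) =
    _ , _ , w , ρ , σ , inj₁ (x≤x′ , ne , acts)
  good-pair⇒loop ρ (just α) (just β) (_ , same , c≤c′) (inj₂ τ)
    with anchor-loop α β (suc-injective same) c≤c′ τ
  ... | y , w , σ , x≤₁y , ne = _ , y , w , ρ , σ , inj₂ (x≤₁y , ne)
  good-pair⇒loop ρ nothing (just β) (_ , () , _) (inj₂ _)

  module InfiniteRun (q : Q) (xs : ℕ → Conf) (ρ₀ : Reach qin xin q (xs 0))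
                     (segment : ∀ j → Reach⁺ q (xs j) q (xs (suc j))) where

    loopAt : ∀ j → Steps q (xs j) (proj₁ (segment j)) q (xs (suc j))
    loopAt j = proj₂ (proj₂ (segment j))

    nonemptyAt : ∀ j → 1 ≤ length (proj₁ (segment j))
    nonemptyAt j = proj₁ (proj₂ (segment j))

    prefix : ∀ j → Reach qin xin q (xs j)
    prefix zero    = ρ₀
    prefix (suc j) = reach-trans (prefix j) (forget-nonempty (segment j))

    latest : ∀ j → Maybe (Anchor q (xs j))
    latest zero    = nothing
    latest (suc j) = next (loopAt j) (latest j)

    linked : ∀ {i k} → i ≤′ k → Linked q (xs i) (xs (suc k)) (latest (suc k))
    linked {i} ≤′-refl        = linked-start (loopAt i) (nonemptyAt i) (latest i)
    linked     (≤′-step {k} p) = linked-step (loopAt (suc k)) (latest (suc k)) (linked p)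

    -- By almost-fullness two keys along the run are ≼-related, and the
    -- linking invariant turns that pair into a good loop.
    goodLoop : GoodLoop q
    goodLoop with af-good af-≼ (λ j → key (xs j) (latest j))
    ... | i , suc k , s≤s i≤k , i≼k =
      good-pair⇒loop (prefix i) (latest i) (latest (suc k)) i≼k (linked (≤⇒≤′ i≤k))

  visited⇒loop : ∀ q → VisitedInfinitelyOften q → GoodLoop q
  visited⇒loop q (xs , ρ₀ , segment) = InfiniteRun.goodLoop q xs ρ₀ segment

lemma7p2 : (d : ℕ) (V : VASSZ (suc d)) (qf : VASSZ.Q V) →
    let open VASSZ V in
    let open Semantics V in
    VisitedInfinitelyOften qf ⇔
      (Σ[ x ∈ ℕ^ (suc d) ] Σ[ y ∈ ℕ^ (suc d) ] Σ[ w ∈ Word ]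
        (Reach qin xin qf x × Steps qf x w qf y ×
          ((x ≤ᵥ y × 1 ≤ length w × All IsAct w)
           ⊎ (x ≤₁ y × 1 ≤ length w))))
lemma7p2 d V qf = mk⇔ (Loops.visited⇒loop V qf) (Loops.loop⇒visited V qf)
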